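{- Let $k\ge 1$ and $n\ge 3k$ be integers. If the Kneser graph $K(k,n)$ has a resolving set $S$ of cardinality $g$, then there exists a $k$-detectable, $k$-uniform hypergraph on $n$ vertices with $g$ hyperedges.
   Context: For integers $n>k\ge 1$, the Kneser graph $K(k,n)$ has as vertices the $k$-element subsets of $[n]=\{1,\dots,n\}$, two vertices adjacent iff disjoint. A set $S$ of vertices of a connected graph is resolving if distinct vertices have distinct vectors of distances to the elements of $S$. Hypergraph detection: let $H$ be a hypergraph with hyperedges $h_1,\dots,h_g$, each of cardinality at most $k$. For a set $B$ of $k'\le k$ vertices, its detection vector is $(p_1,\dots,p_g)$ where $p_i=0$ if $h_i\cap B=\emptyset$, $p_i=k$ if $|h_i\cap B|=k$, and $p_i=1$ otherwise. $H$ is $k'$-detectable if any two distinct $k'$-element vertex sets $B_1\ne B_2$ have distinct detection vectors. A hypergraph is $k$-uniform if all hyperedges have cardinality $k$. -}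

module Defs where

open import Data.Nat using (ℕ; zero; suc; _≤_)
open import Data.Fin using (Fin)
open import Data.Fin.Subset using (Subset; ∣_∣; _∩_; Empty)
open import Data.Product using (Σ; _×_; _,_)
open import Relation.Binary.PropositionalEquality using (_≡_)
open import Relation.Nullary using (¬_)
open import Function.Bundles using (_⇔_)

KVertex : ℕ → ℕ → Set
KVertex k n = Σ (Subset n) (λ A → ∣ A ∣ ≡ k)

Adj : ∀ {k n} → KVertex k n → KVertex k n → Set
Adj (A , _) (B , _) = Empty (A ∩ B)

data Walk {k n : ℕ} : KVertex k n → KVertex k n → ℕ → Set where
  here : ∀ {u} → Walk u u zero
  step : ∀ {u v w m} → Adj u v → Walk v w m → Walk u w (suc m)

IsDist : ∀ {k n} → KVertex k n → KVertex k n → ℕ → Set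
IsDist u v m = Walk u v m × (∀ m' → Walk u v m' → m ≤ m')

-- S : Fin g → KVertex k n is a set of g vertices: injective enumeration.
Distinct : ∀ {g} {A : Set} → (Fin g → A) → Set
Distinct {g} S = ∀ (i j : Fin g) → S i ≡ S j → i ≡ j

Resolving : ∀ {k n g} → (Fin g → KVertex k n) → Set
Resolving {k} {n} {g} S =
  ∀ (x y : KVertex k n) →
  (∀ (i : Fin g) (m : ℕ) → IsDist x (S i) m ⇔ IsDist y (S i) m) →
  x ≡ y

data DetVal : Set where
  zeroV oneV kV : DetVal

data HasDet {n : ℕ} (k : ℕ) (h B : Subset n) : DetVal → Set where
  det0 : Empty (h ∩ B) → HasDet k h B zeroV
  detk : ∣ h ∩ B ∣ ≡ k → HasDet k h B kV
  det1 : ¬ Empty (h ∩ B) → ¬ (∣ h ∩ B ∣ ≡ k) → HasDet k h B oneV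

Hypergraph : ℕ → ℕ → Set
Hypergraph n g = Fin g → Subset n

Uniform : ∀ {n g} → ℕ → Hypergraph n g → Set
Uniform {n} {g} k H = ∀ (i : Fin g) → ∣ H i ∣ ≡ k

Detectable : ∀ {n g} → ℕ → ℕ → Hypergraph n g → Set
Detectable {n} {g} k k' H =
  ∀ (B₁ B₂ : Subset n) → ∣ B₁ ∣ ≡ k' → ∣ B₂ ∣ ≡ k' →
  (∀ (i : Fin g) (p : DetVal) → HasDet k (H i) B₁ p ⇔ HasDet k (H i) B₂ p) →
  B₁ ≡ B₂

module Submission where

-- The key fact is that for n ≥ 3k the distance between two vertices X, A of
-- K(k,n) is a function of the detection value of the hyperedge A with respect
-- to the set X:  |A ∩ X| = k  means X = A (distance 0),  A ∩ X = ∅  means X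
-- and A are adjacent (distance 1), and otherwise the distance is 2, because
-- |X ∪ A| ≤ 2k leaves at least k points of [n] from which to build a common
-- neighbour.  Hence two k-sets with the same detection vector have the same
-- distance vector to S, and are equal since S is resolving.

open import Defs
open import Data.Nat using (ℕ; _≤_; _*_)
open import Data.Fin using (Fin)
open import Data.Product using (Σ; _×_)

open import Data.Nat using (zero; suc; _+_; z≤n; s≤s)
open import Data.Nat.Properties
  using (+-suc; suc-injective; <⇒≢; ≤-pred; ≤-antisym;
         m≤m+n; +-monoʳ-≤; +-identityʳ; ≡-irrelevant; _≟_; module ≤-Reasoning)
open import Data.Fin using (zero; suc)
open import Data.Bool using (true; false)
open import Data.Vec using ([]; _∷_; there)
open import Data.Fin.Subset using (Subset; ∣_∣; _∩_; _∪_; Empty)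
open import Data.Fin.Subset.Properties
  using (∩-comm; ∩-idem; Empty-unique; ∣⊥∣≡0; ∣p∣≤n; ∣p∩q∣≤∣p∣; ∣p∩q∣≤∣q∣;
         nonempty?; x∈p∩q⁺; x∈p∩q⁻; x∈p∪q⁺)
open import Data.Product using (_,_; proj₁; proj₂)
open import Data.Sum using (inj₁; inj₂)
open import Function using (_∘_)
open import Function.Bundles using (_⇔_; mk⇔; Equivalence)
open import Relation.Nullary using (¬_; yes; no; contradiction)
open import Relation.Binary.PropositionalEquality
  using (_≡_; refl; sym; trans; cong; cong₂; subst; module ≡-Reasoning)

Empty⇒∣p∣≡0 : ∀ {n} {p : Subset n} → Empty p → ∣ p ∣ ≡ 0
Empty⇒∣p∣≡0 {n} e = trans (cong ∣_∣ (Empty-unique e)) (∣⊥∣≡0 n)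

∣p∪q∣+∣p∩q∣ : ∀ {n} (p q : Subset n) → ∣ p ∪ q ∣ + ∣ p ∩ q ∣ ≡ ∣ p ∣ + ∣ q ∣
∣p∪q∣+∣p∩q∣ [] [] = refl
∣p∪q∣+∣p∩q∣ (true ∷ p) (true ∷ q) =
  cong suc (trans (+-suc _ _) (trans (cong suc (∣p∪q∣+∣p∩q∣ p q)) (sym (+-suc _ _))))
∣p∪q∣+∣p∩q∣ (true ∷ p) (false ∷ q) = cong suc (∣p∪q∣+∣p∩q∣ p q)
∣p∪q∣+∣p∩q∣ (false ∷ p) (true ∷ q) = trans (cong suc (∣p∪q∣+∣p∩q∣ p q)) (sym (+-suc _ _))
∣p∪q∣+∣p∩q∣ (false ∷ p) (false ∷ q) = ∣p∪q∣+∣p∩q∣ p q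

∩-full⇒≡ : ∀ {n} (p q : Subset n) → ∣ p ∩ q ∣ ≡ ∣ p ∣ → ∣ p ∩ q ∣ ≡ ∣ q ∣ → p ≡ q
∩-full⇒≡ [] [] _ _ = refl
∩-full⇒≡ (true ∷ p) (true ∷ q) e₁ e₂ =
  cong (true ∷_) (∩-full⇒≡ p q (suc-injective e₁) (suc-injective e₂))
∩-full⇒≡ (true ∷ p) (false ∷ q) e₁ _ = contradiction e₁ (<⇒≢ (s≤s (∣p∩q∣≤∣p∣ p q)))
∩-full⇒≡ (false ∷ p) (true ∷ q) _ e₂ = contradiction e₂ (<⇒≢ (s≤s (∣p∩q∣≤∣q∣ p q)))
∩-full⇒≡ (false ∷ p) (false ∷ q) e₁ e₂ = cong (false ∷_) (∩-full⇒≡ p q e₁ e₂)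

skip-head : ∀ {n} {p : Subset n} → Empty p → Empty (false ∷ p)
skip-head p=∅ (suc x , there x∈p) = p=∅ (x , x∈p)

avoid : ∀ {n} (U : Subset n) (k : ℕ) → k + ∣ U ∣ ≤ n →
  Σ (Subset n) λ C → ∣ C ∣ ≡ k × Empty (C ∩ U)
avoid [] zero _ = [] , refl , λ { (() , _) }
avoid [] (suc k) ()
avoid {suc n} (true ∷ U) k k+∣U∣<1+n
  with avoid U k (≤-pred (subst (_≤ suc n) (+-suc k ∣ U ∣) k+∣U∣<1+n))
... | C , ∣C∣≡k , C∩U=∅ = false ∷ C , ∣C∣≡k , skip-head C∩U=∅
avoid (false ∷ U) zero _ with avoid U zero (∣p∣≤n U)
... | C , ∣C∣≡0 , C∩U=∅ = false ∷ C , ∣C∣≡0 , skip-head C∩U=∅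
avoid (false ∷ U) (suc k) k+∣U∣<1+n with avoid U k (≤-pred k+∣U∣<1+n)
... | C , ∣C∣≡k , C∩U=∅ = true ∷ C , cong suc ∣C∣≡k , skip-head C∩U=∅

avoids-∪ˡ : ∀ {n} (c p q : Subset n) → Empty (c ∩ (p ∪ q)) → Empty (p ∩ c)
avoids-∪ˡ c p q c∩[p∪q]=∅ (x , x∈p∩c) =
  let x∈p , x∈c = x∈p∩q⁻ p c x∈p∩c
  in c∩[p∪q]=∅ (x , x∈p∩q⁺ (x∈c , x∈p∪q⁺ (inj₁ x∈p)))

avoids-∪ʳ : ∀ {n} (c p q : Subset n) → Empty (c ∩ (p ∪ q)) → Empty (c ∩ q)
avoids-∪ʳ c p q c∩[p∪q]=∅ (x , x∈c∩q) =
  let x∈c , x∈q = x∈p∩q⁻ c q x∈c∩q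
  in c∩[p∪q]=∅ (x , x∈p∩q⁺ (x∈c , x∈p∪q⁺ {p = p} (inj₂ x∈q)))

room-outside : ∀ {k n} (p q : Subset n) → ∣ p ∣ ≡ k → ∣ q ∣ ≡ k → 3 * k ≤ n →
  k + ∣ p ∪ q ∣ ≤ n
room-outside {k} {n} p q ∣p∣≡k ∣q∣≡k 3k≤n = begin
  k + ∣ p ∪ q ∣                ≤⟨ +-monoʳ-≤ k (m≤m+n ∣ p ∪ q ∣ ∣ p ∩ q ∣) ⟩
  k + (∣ p ∪ q ∣ + ∣ p ∩ q ∣)  ≡⟨ cong (k +_) (∣p∪q∣+∣p∩q∣ p q) ⟩
  k + (∣ p ∣ + ∣ q ∣)          ≡⟨ cong (k +_) (cong₂ _+_ ∣p∣≡k ∣q∣≡k) ⟩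
  k + (k + k)                  ≡⟨ cong (λ t → k + (k + t)) (sym (+-identityʳ k)) ⟩
  3 * k                        ≤⟨ 3k≤n ⟩
  n                            ∎
  where open ≤-Reasoning

module _ {k n : ℕ} where

  KVertex-≡ : {x y : KVertex k n} → proj₁ x ≡ proj₁ y → x ≡ y
  KVertex-≡ {X , ∣X∣≡k} {.X , ∣X∣≡k′} refl = cong (X ,_) (≡-irrelevant ∣X∣≡k ∣X∣≡k′)

  full-overlap⇒≡ : (x a : KVertex k n) → ∣ proj₁ a ∩ proj₁ x ∣ ≡ k → x ≡ a
  full-overlap⇒≡ (X , ∣X∣≡k) (A , ∣A∣≡k) ∣A∩X∣≡k =
    KVertex-≡ (∩-full⇒≡ X A (trans ∣X∩A∣≡k (sym ∣X∣≡k)) (trans ∣X∩A∣≡k (sym ∣A∣≡k)))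
    where ∣X∩A∣≡k : ∣ X ∩ A ∣ ≡ k
          ∣X∩A∣≡k = trans (cong ∣_∣ (∩-comm X A)) ∣A∩X∣≡k

  ¬Adj-refl : 1 ≤ k → (x : KVertex k n) → ¬ Adj x x
  ¬Adj-refl 1≤k (X , ∣X∣≡k) X∩X=∅ = <⇒≢ 1≤k (begin
    0          ≡⟨ sym (Empty⇒∣p∣≡0 X∩X=∅) ⟩
    ∣ X ∩ X ∣  ≡⟨ cong ∣_∣ (∩-idem X) ⟩
    ∣ X ∣      ≡⟨ ∣X∣≡k ⟩
    k          ∎)
    where open ≡-Reasoning

  -- When n ≥ 3k any two vertices have a common neighbour: a k-set
  -- avoiding both of them.
  common-neighbour : 3 * k ≤ n → (x y : KVertex k n) →
    Σ (KVertex k n) λ z → Adj x z × Adj z y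
  common-neighbour 3k≤n (X , ∣X∣≡k) (Y , ∣Y∣≡k)
    with avoid (X ∪ Y) k (room-outside X Y ∣X∣≡k ∣Y∣≡k 3k≤n)
  ... | C , ∣C∣≡k , C∩[X∪Y]=∅ =
    (C , ∣C∣≡k) , avoids-∪ˡ C X Y C∩[X∪Y]=∅ , avoids-∪ʳ C X Y C∩[X∪Y]=∅

  walk-length-≥1 : {x a : KVertex k n} → ¬ x ≡ a → ∀ m → Walk x a m → 1 ≤ m
  walk-length-≥1 x≢a zero here = contradiction refl x≢a
  walk-length-≥1 _ (suc m) _ = s≤s z≤n

  walk-length-≥2 : {x a : KVertex k n} → ¬ x ≡ a → ¬ Adj x a →
    ∀ m → Walk x a m → 2 ≤ m
  walk-length-≥2 x≢a _ zero here = contradiction refl x≢a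
  walk-length-≥2 _ ¬x~a (suc zero) (step x~a here) = contradiction x~a ¬x~a
  walk-length-≥2 _ _ (suc (suc m)) _ = s≤s (s≤s z≤n)

  IsDist-unique : {x a : KVertex k n} {m m′ : ℕ} → IsDist x a m → IsDist x a m′ → m ≡ m′
  IsDist-unique (w , shortest) (w′ , shortest′) = ≤-antisym (shortest _ w′) (shortest′ _ w)

  detection-value : (h B : Subset n) → Σ DetVal (HasDet k h B)
  detection-value h B with nonempty? (h ∩ B)
  ... | no h∩B=∅ = zeroV , det0 h∩B=∅
  ... | yes h∩B≠∅ with ∣ h ∩ B ∣ ≟ k
  ...   | yes full = kV , detk full
  ...   | no ¬full = oneV , det1 (λ h∩B=∅ → h∩B=∅ h∩B≠∅) ¬full

kneserDist : DetVal → ℕ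
kneserDist kV    = 0
kneserDist zeroV = 1
kneserDist oneV  = 2

module _ {k n : ℕ} (1≤k : 1 ≤ k) (3k≤n : 3 * k ≤ n) where

  detection⇒distance : (x a : KVertex k n) {p : DetVal} →
    HasDet k (proj₁ a) (proj₁ x) p → IsDist x a (kneserDist p)
  detection⇒distance x a (detk full) =
    subst (λ y → IsDist y a 0) (sym (full-overlap⇒≡ x a full)) (here , λ _ _ → z≤n)
  detection⇒distance x@(X , _) a@(A , _) (det0 A∩X=∅) =
    step x~a here , walk-length-≥1 x≢a
    where x~a : Adj x a
          x~a = subst Empty (∩-comm A X) A∩X=∅
          x≢a : ¬ x ≡ a
          x≢a x≡a = ¬Adj-refl 1≤k a (subst (λ y → Adj y a) x≡a x~a)
  detection⇒distance x@(X , _) a@(A , ∣A∣≡k) (det1 A∩X≠∅ ∣A∩X∣≢k)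
    with common-neighbour 3k≤n x a
  ... | z , x~z , z~a = step {v = z} x~z (step z~a here) , walk-length-≥2 x≢a ¬x~a
    where x≢a : ¬ x ≡ a
          x≢a x≡a = ∣A∩X∣≢k (begin
            ∣ A ∩ X ∣  ≡⟨ cong (λ y → ∣ A ∩ proj₁ y ∣) x≡a ⟩
            ∣ A ∩ A ∣  ≡⟨ cong ∣_∣ (∩-idem A) ⟩
            ∣ A ∣      ≡⟨ ∣A∣≡k ⟩
            k          ∎)
            where open ≡-Reasoning
          ¬x~a : ¬ Adj x a
          ¬x~a x~a = A∩X≠∅ (subst Empty (∩-comm X A) x~a)

  same-detection⇒same-distance : (x y a : KVertex k n) →
    (∀ p → HasDet k (proj₁ a) (proj₁ x) p ⇔ HasDet k (proj₁ a) (proj₁ y) p) →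
    ∀ m → IsDist x a m ⇔ IsDist y a m
  same-detection⇒same-distance x y a same m with detection-value (proj₁ a) (proj₁ x)
  ... | p , x-has-p = mk⇔
    (λ d → subst (IsDist y a) (IsDist-unique dx d) dy)
    (λ d → subst (IsDist x a) (IsDist-unique dy d) dx)
    where dx = detection⇒distance x a x-has-p
          dy = detection⇒distance y a (Equivalence.to (same p) x-has-p)

mainTheorem3 : ∀ (k n g : ℕ) → 1 ≤ k → 3 * k ≤ n →
    (S : Fin g → KVertex k n) → Distinct S → Resolving S →
    Σ (Hypergraph n g) (λ H → Uniform k H × Detectable k k H)
mainTheorem3 k n g 1≤k 3k≤n S _ resolving = proj₁ ∘ S , proj₂ ∘ S , detectable
  where
  detectable : Detectable k k (proj₁ ∘ S)
  detectable B₁ B₂ ∣B₁∣≡k ∣B₂∣≡k same-detection =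
    cong proj₁ (resolving (B₁ , ∣B₁∣≡k) (B₂ , ∣B₂∣≡k) λ i →
      same-detection⇒same-distance 1≤k 3k≤n _ _ (S i) (same-detection i))
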